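{- Let $X$ be a finite set with $|X|\ge3$, let $\mathfrak D\subseteq\mathfrak C^{\mathrm{full}}$ be non-empty and symmetric, and let $c\in\mathfrak C$ be pseudo-balanced. Then $c\in\mathrm{maj\text{ - }cl}(\mathfrak D)$.
   Context: $\mathfrak C$ is the set of partial choice functions on two-element subsets of $X$ ($c\{x,y\}\in\{x,y\}$ when defined), $\mathfrak C^{\mathrm{full}}$ those defined on all pairs. A permutation $\pi$ of $X$ acts by $\hat\pi(c)\{\pi(x),\pi(y)\}=\pi(c\{x,y\})$; symmetric means closed under this action. $\mathrm{Tor}[c]$ is the directed graph on $X$ with edges $(x,y)$ where $c\{x,y\}=y$; $c$ is pseudo-balanced if every edge of $\mathrm{Tor}[c]$ lies on a directed cycle. $\bar t[d]=\langle t_{x,y}[d]:x\ne y\rangle$ with $t_{x,y}[d]=1$ if $d\{x,y\}=y$, $0$ if $d\{x,y\}=x$, $\tfrac12$ if undefined; $\mathrm{pr\text{ - }cl}(\mathfrak D)$ is the convex hull of $\{\bar t[d]:d\in\mathfrak D\}$; for such $\bar t$, $\mathrm{maj}(\bar t)\{x,y\}=y\iff t_{x,y}>\tfrac12$ (undefined if $t_{x,y}=\tfrac12$); $\mathrm{maj\text{ - }cl}(\mathfrak D)=\{\mathrm{maj}(\bar t):\bar t\in\mathrm{pr\text{ - }cl}(\mathfrak D)\}$. -}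

module Defs where

open import Data.Nat using (ℕ)
open import Data.Fin using (Fin; _≟_)
open import Data.Fin.Permutation using (Permutation′; _⟨$⟩ʳ_; _⟨$⟩ˡ_)
open import Data.Maybe using (Maybe; just; nothing)
import Data.Maybe as Maybe
open import Data.Rational using (ℚ; 0ℚ; 1ℚ; ½; _+_; _*_; _≤_; _<_)
open import Data.Rational.Properties using (_<?_)
open import Data.List using (List; []; _∷_)
open import Data.List.Relation.Unary.All using (All)
open import Data.Product using (Σ; ∃; _×_; _,_)
open import Data.Sum using (_⊎_)
open import Relation.Binary.PropositionalEquality using (_≡_; _≢_)
open import Relation.Binary.Construct.Closure.ReflexiveTransitive using (Star)
open import Relation.Nullary using (yes; no)

-- The ground set X is Fin n.
-- A (partial) choice function on two-element subsets of X is represented by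
-- c : X → X → Maybe X, where c x y is the value c{x,y} (nothing = undefined).
ChoiceFn : ℕ → Set
ChoiceFn n = Fin n → Fin n → Maybe (Fin n)

-- c ∈ 𝔆 : c is defined only on two-element sets, symmetric in the
-- two arguments (so it is a function of the set {x,y}), and c{x,y} ∈ {x,y}.
record IsChoice {n : ℕ} (c : ChoiceFn n) : Set where
  field
    diag   : ∀ x → c x x ≡ nothing
    unord  : ∀ x y → c x y ≡ c y x
    choose : ∀ x y z → c x y ≡ just z → (z ≡ x) ⊎ (z ≡ y)

record IsFullChoice {n : ℕ} (c : ChoiceFn n) : Set where
  field
    isChoice : IsChoice c
    total    : ∀ x y → x ≢ y → ∃ λ z → c x y ≡ just z

-- Action of a permutation: π̂(c){π x, π y} = π (c{x,y}).
act : ∀ {n} → Permutation′ n → ChoiceFn n → ChoiceFn n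
act π c u v = Maybe.map (π ⟨$⟩ʳ_) (c (π ⟨$⟩ˡ u) (π ⟨$⟩ˡ v))

Symmetric : ∀ {n} → (ChoiceFn n → Set) → Set
Symmetric {n} 𝔇 = ∀ (π : Permutation′ n) (d : ChoiceFn n) → 𝔇 d → 𝔇 (act π d)

TorEdge : ∀ {n} → ChoiceFn n → Fin n → Fin n → Set
TorEdge c x y = (x ≢ y) × (c x y ≡ just y)

PseudoBalanced : ∀ {n} → ChoiceFn n → Set
PseudoBalanced c = ∀ x y → TorEdge c x y → Star (TorEdge c) y x

-- The vector t̄[d] (diagonal entries are irrelevant).
tvec : ∀ {n} → ChoiceFn n → Fin n → Fin n → ℚ
tvec d x y with d x y
... | nothing = ½
... | just z with z ≟ y
...   | yes _ = 1ℚ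
...   | no  _ = 0ℚ

weightSum : ∀ {n} → List (ℚ × ChoiceFn n) → ℚ
weightSum [] = 0ℚ
weightSum ((l , _) ∷ L) = l + weightSum L

combo : ∀ {n} → List (ℚ × ChoiceFn n) → Fin n → Fin n → ℚ
combo [] x y = 0ℚ
combo ((l , d) ∷ L) x y = l * tvec d x y + combo L x y

InPrCl : ∀ {n} → (ChoiceFn n → Set) → (Fin n → Fin n → ℚ) → Set
InPrCl {n} 𝔇 t =
  Σ (List (ℚ × ChoiceFn n)) λ L →
    All (λ p → (0ℚ ≤ Data.Product.proj₁ p) × 𝔇 (Data.Product.proj₂ p)) L
    × weightSum L ≡ 1ℚ
    × (∀ x y → x ≢ y → t x y ≡ combo L x y)

maj : ∀ {n} → (Fin n → Fin n → ℚ) → ChoiceFn n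
maj t x y with x ≟ y
... | yes _ = nothing
... | no _ with ½ <? t x y
...   | yes _ = just y
...   | no _ with t x y <? ½
...     | yes _ = just x
...     | no _ = nothing

InMajCl : ∀ {n} → (ChoiceFn n → Set) → ChoiceFn n → Set
InMajCl {n} 𝔇 c = ∃ λ (t : Fin n → Fin n → ℚ) → InPrCl 𝔇 t × (∀ x y → maj t x y ≡ c x y)

-- Write f_d(a, b) = 2 t_{a,b}[d] - 1 ∈ {-1, 0, 1} for the flow of a choice function d.  If a
-- non-empty multiset of N members of 𝔇 has total flow F, the uniform mixture of their vectors
-- t̄[d] is ½ + F / 2N, so c ∈ maj-cl(𝔇) as soon as some such F is positive on the arcs of Tor[c]
-- and zero on the pairs where c is undefined.
--
-- Since 𝔇 is symmetric, realisable total flows are closed under relabelling, and also under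
-- negation: the flows of the dihedral orbit of d sum to zero, because for any pair a, b some
-- reflection swaps a and b.  Hence the alternating sum over the permutations of three points
-- x, y, z is realisable; for a full d it is 2σ times the triangle flow x → y → z → x, where
-- σ = f_d(x, y) + f_d(y, z) + f_d(z, x) is odd, hence non-zero.  So for one fixed K > 0 every
-- triangle flow times K is realisable, and with it K times the flow of any closed walk, cut into
-- a fan of triangles.  Pseudo-balance gives a cycle of Tor[c] through each arc, and the sum of
-- these cycle flows is positive on every arc of Tor[c] and zero wherever c is undefined.

{-# OPTIONS --safe #-}
module Submission where

open import Defs
open import Data.Nat using (ℕ; _≥_)
open import Data.Product using (∃)

open import Data.Nat as ℕ using (zero; suc; s≤s; z≤n; z<s)
import Data.Nat.Properties as ℕ
open import Data.Nat.DivMod using (_%_; _mod_; %-distribˡ-+; m%n%n≡m%n; [m+n]%n≡m%n; [m+kn]%n≡m%n; m<n⇒m%n≡m)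
import Data.Nat.Tactic.RingSolver as ℕ-Solver
open import Data.Fin as Fin using (Fin; _≟_; toℕ; opposite)
import Data.Fin.Properties as Fin
open import Data.Fin.Patterns using (0F; 1F; 2F)
open import Data.Fin.Permutation as Perm
  using (Permutation′; _⟨$⟩ʳ_; _⟨$⟩ˡ_; _∘ₚ_; inverseˡ; inverseʳ; transpose)
import Data.Fin.Permutation.Components as PC
open import Data.Maybe as Maybe using (Maybe; just; nothing)
import Data.Maybe.Properties as Maybe
open import Data.Integer as ℤ using (ℤ; 0ℤ; 1ℤ; -1ℤ; -_; _+_; _*_; _-_; _≤_; _<_)
import Data.Integer.Properties as ℤ
open import Data.Integer.Tactic.RingSolver using (solve-∀)
open import Data.List using (List; []; _∷_; _++_; map; tabulate; length)
open import Data.Rational as ℚ using (ℚ; mkℚ; 0ℚ; 1ℚ; ½; 1/_)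
import Data.Rational.Properties as ℚ
import Data.Rational.Unnormalised as ℚᵘ
import Data.Rational.Unnormalised.Properties as ℚᵘ
open import Data.Nat.Coprimality as Coprimality using (1-coprimeTo)
open import Data.List.Relation.Unary.All as All using (All; []; _∷_)
import Data.List.Relation.Unary.All.Properties as All
open import Data.Product using (Σ-syntax; _×_; _,_; proj₁; proj₂)
open import Data.Sum using (_⊎_; inj₁; inj₂)
open import Data.Empty using (⊥-elim)
open import Data.Bool using (if_then_else_)
open import Function using (_∘_)
open import Function.Definitions using (Injective)
open import Relation.Nullary using (¬_; Dec; yes; no; does)
open import Relation.Nullary.Decidable using (dec-true; dec-false; ¬?; _×-dec_)
open import Relation.Binary.Definitions using (tri<; tri≈; tri>)
open import Relation.Binary.Construct.Closure.ReflexiveTransitive using (Star; ε; _◅_)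
open import Relation.Binary.PropositionalEquality
open ≡-Reasoning
open import Algebra.Properties.AbelianGroup ℤ.+-0-abelianGroup using (inverseʳ-unique)
open import Algebra.Bundles using (CommutativeMonoid)
open import Algebra.Properties.CommutativeSemigroup (CommutativeMonoid.commutativeSemigroup ℚ.*-1-commutativeMonoid)
  using (x∙yz≈y∙xz)
open import Algebra.Properties.CommutativeMonoid.Sum ℤ.+-0-commutativeMonoid
  using (sum; sum-permute; sum-cong-≗; ∑-distrib-+; sum-replicate-zero)
open import Algebra.Properties.Semiring.Sum ℤ.+-*-semiring using (*-distribˡ-sum)

private
  variable
    n : ℕ

Flow : ℕ → Set
Flow n = Fin n → Fin n → ℤ

infix 4 _≐_
_≐_ : Flow n → Flow n → Set
F ≐ G = ∀ a b → F a b ≡ G a b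

Antisymmetric : Flow n → Set
Antisymmetric F = ∀ a b → F a b ≡ - F b a

infixl 6 _⊕_
infixl 7 _·_

0ᶠ : Flow n
0ᶠ _ _ = 0ℤ

_⊕_ : Flow n → Flow n → Flow n
(F ⊕ G) a b = F a b + G a b

⊖_ : Flow n → Flow n
(⊖ F) a b = - F a b

_·_ : ℤ → Flow n → Flow n
(k · F) a b = k * F a b

relabel : Permutation′ n → Flow n → Flow n
relabel π F a b = F (π ⟨$⟩ˡ a) (π ⟨$⟩ˡ b)

⊕-antisym : ∀ {F G : Flow n} → Antisymmetric F → Antisymmetric G → Antisymmetric (F ⊕ G)
⊕-antisym {F = F} {G} antiF antiG a b =
  trans (cong₂ _+_ (antiF a b) (antiG a b)) (sym (ℤ.neg-distrib-+ (F b a) (G b a)))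

⊖-antisym : ∀ {F : Flow n} → Antisymmetric F → Antisymmetric (⊖ F)
⊖-antisym antiF a b = cong -_ (antiF a b)

relabel-antisym : ∀ π {F : Flow n} → Antisymmetric F → Antisymmetric (relabel π F)
relabel-antisym π antiF a b = antiF (π ⟨$⟩ˡ a) (π ⟨$⟩ˡ b)

vote : Fin n → Maybe (Fin n) → ℤ
vote b nothing = 0ℤ
vote b (just z) = if does (z ≟ b) then 1ℤ else -1ℤ

flow : ChoiceFn n → Flow n
flow d a b = vote b (d a b)

vote-self : ∀ (b : Fin n) → vote b (just b) ≡ 1ℤ
vote-self b rewrite dec-true (b ≟ b) refl = refl

vote-other : ∀ {z b : Fin n} → z ≢ b → vote b (just z) ≡ -1ℤ
vote-other {z = z} {b} z≢b rewrite dec-false (z ≟ b) z≢b = refl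

defined⇒distinct : ∀ {d : ChoiceFn n} {a b z} → IsChoice d → d a b ≡ just z → a ≢ b
defined⇒distinct isC eq refl with trans (sym (IsChoice.diag isC _)) eq
... | ()

flow-antisym : ∀ {d : ChoiceFn n} → IsChoice d → Antisymmetric (flow d)
flow-antisym {d = d} isC a b rewrite IsChoice.unord isC b a with d a b in eq
... | nothing = refl
... | just z with IsChoice.choose isC a b z eq
...   | inj₁ refl rewrite vote-self z | vote-other (defined⇒distinct isC eq) = refl
...   | inj₂ refl rewrite vote-self z | vote-other (defined⇒distinct isC eq ∘ sym) = refl

flow-unit : ∀ {d : ChoiceFn n} {a b} → IsFullChoice d → a ≢ b → flow d a b ≡ 1ℤ ⊎ flow d a b ≡ -1ℤ
flow-unit {d = d} {a} {b} full a≢b with IsFullChoice.total full a b a≢b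
... | z , dab≡z rewrite dab≡z with z ≟ b
...   | yes _ = inj₁ refl
...   | no  _ = inj₂ refl

vote-permute : ∀ (π : Permutation′ n) b m → vote b (Maybe.map (π ⟨$⟩ʳ_) m) ≡ vote (π ⟨$⟩ˡ b) m
vote-permute π b nothing = refl
vote-permute π b (just z) with π ⟨$⟩ʳ z ≟ b | z ≟ π ⟨$⟩ˡ b
... | yes _ | yes _ = refl
... | no  _ | no  _ = refl
... | yes πz≡b | no z≢π⁻¹b = ⊥-elim (z≢π⁻¹b (trans (sym (inverseˡ π)) (cong (π ⟨$⟩ˡ_) πz≡b)))
... | no πz≢b | yes z≡π⁻¹b = ⊥-elim (πz≢b (trans (cong (π ⟨$⟩ʳ_) z≡π⁻¹b) (inverseʳ π)))

flow-act : ∀ π (d : ChoiceFn n) → flow (act π d) ≐ relabel π (flow d)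
flow-act π d a b = vote-permute π b (d (π ⟨$⟩ˡ a) (π ⟨$⟩ˡ b))

δ : Fin n → Fin n → ℤ
δ a p = if does (a ≟ p) then 1ℤ else 0ℤ

edge : Fin n → Fin n → Flow n
edge p q a b = δ a p * δ b q - δ a q * δ b p

triangle : Fin n → Fin n → Fin n → Flow n
triangle p q r = edge p q ⊕ edge q r ⊕ edge r p

edge-swap : ∀ (p q : Fin n) → edge q p ≐ ⊖ edge p q
edge-swap p q a b = swap-difference (δ a p) (δ b q) (δ a q) (δ b p)
  where
  swap-difference : ∀ w x y z → y * z - w * x ≡ - (w * x - y * z)
  swap-difference = solve-∀

edge-diag : ∀ (p : Fin n) → edge p p ≐ 0ᶠ
edge-diag p a b = ℤ.+-inverseʳ (δ a p * δ b p)

δ-injective : ∀ {g : Fin n → Fin n} → Injective _≡_ _≡_ g → ∀ a p → δ (g a) (g p) ≡ δ a p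
δ-injective {g = g} inj a p with a ≟ p | g a ≟ g p
... | yes _ | yes _ = refl
... | no  _ | no  _ = refl
... | yes refl | no ga≢ga = ⊥-elim (ga≢ga refl)
... | no a≢p | yes ga≡gp = ⊥-elim (a≢p (inj ga≡gp))

triangle-injective : ∀ {g : Fin n → Fin n} → Injective _≡_ _≡_ g →
                     ∀ p q r a b → triangle (g p) (g q) (g r) (g a) (g b) ≡ triangle p q r a b
triangle-injective inj p q r a b
  rewrite δ-injective inj a p | δ-injective inj a q | δ-injective inj a r
        | δ-injective inj b p | δ-injective inj b q | δ-injective inj b r = refl

triangle-degenerate : ∀ (p q r : Fin n) → p ≡ q ⊎ q ≡ r ⊎ r ≡ p → triangle p q r ≐ 0ᶠ
triangle-degenerate p .p r (inj₁ refl) a b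
  rewrite edge-diag p a b | edge-swap p r a b = cancel (edge p r a b)
  where
  cancel : ∀ x → 0ℤ + x + - x ≡ 0ℤ
  cancel = solve-∀
triangle-degenerate p q .q (inj₂ (inj₁ refl)) a b
  rewrite edge-diag q a b | edge-swap p q a b = cancel (edge p q a b)
  where
  cancel : ∀ x → x + 0ℤ + - x ≡ 0ℤ
  cancel = solve-∀
triangle-degenerate p q .p (inj₂ (inj₂ refl)) a b
  rewrite edge-diag p a b | edge-swap p q a b = cancel (edge p q a b)
  where
  cancel : ∀ x → x + - x + 0ℤ ≡ 0ℤ
  cancel = solve-∀

δ-refl : ∀ (p : Fin n) → δ p p ≡ 1ℤ
δ-refl p rewrite dec-true (p ≟ p) refl = refl

δ*δ-nonneg : ∀ (a b p q : Fin n) → 0ℤ ≤ δ a p * δ b q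
δ*δ-nonneg a b p q with a ≟ p | b ≟ q
... | yes _ | yes _ = ℤ.+≤+ z≤n
... | yes _ | no  _ = ℤ.+≤+ z≤n
... | no  _ | yes _ = ℤ.+≤+ z≤n
... | no  _ | no  _ = ℤ.+≤+ z≤n

δ*δ-zero : ∀ {a b p q : Fin n} → ¬ (a ≡ p × b ≡ q) → δ a p * δ b q ≡ 0ℤ
δ*δ-zero {a = a} {b} {p} {q} ¬eq with a ≟ p | b ≟ q
... | yes a≡p | yes b≡q = ⊥-elim (¬eq (a≡p , b≡q))
... | yes _ | no  _ = refl
... | no  _ | yes _ = refl
... | no  _ | no  _ = refl

edge-nonneg : ∀ {p q a b : Fin n} → ¬ (a ≡ q × b ≡ p) → 0ℤ ≤ edge p q a b
edge-nonneg {p = p} {q} {a} {b} ¬rev rewrite δ*δ-zero ¬rev =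
  subst (0ℤ ≤_) (sym (ℤ.+-identityʳ _)) (δ*δ-nonneg a b p q)

edge-zero : ∀ {p q a b : Fin n} → ¬ (a ≡ p × b ≡ q) → ¬ (a ≡ q × b ≡ p) → edge p q a b ≡ 0ℤ
edge-zero ¬fwd ¬rev rewrite δ*δ-zero ¬fwd | δ*δ-zero ¬rev = refl

edge-self : ∀ {p q : Fin n} → p ≢ q → edge p q p q ≡ 1ℤ
edge-self {p = p} {q} p≢q
  rewrite δ-refl p | δ-refl q | δ*δ-zero {a = p} {b = q} {p = q} {q = p} (p≢q ∘ proj₁) = refl

permutation-injectiveˡ : ∀ (π : Permutation′ n) → Injective _≡_ _≡_ (π ⟨$⟩ˡ_)
permutation-injectiveˡ π eq = trans (sym (inverseʳ π)) (trans (cong (π ⟨$⟩ʳ_) eq) (inverseʳ π))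

transpose-left : ∀ (i j : Fin n) → PC.transpose i j i ≡ j
transpose-left i j rewrite dec-true (i ≟ i) refl = refl

transpose-fixed : ∀ {i j k : Fin n} → k ≢ i → k ≢ j → PC.transpose i j k ≡ k
transpose-fixed {i = i} {j} {k} k≢i k≢j rewrite dec-false (k ≟ i) k≢i | dec-false (k ≟ j) k≢j = refl

transpose-injective : ∀ (i j : Fin n) → Injective _≡_ _≡_ (PC.transpose i j)
transpose-injective i j eq =
  trans (sym (PC.transpose-inverse j i)) (trans (cong (PC.transpose j i) eq) (PC.transpose-inverse j i))

-- Three transpositions move x, y, z to p, q, r one at a time, each fixing the points already placed.
triple-transitive : ∀ {x y z p q r : Fin n} → x ≢ y → y ≢ z → z ≢ x → p ≢ q → q ≢ r → r ≢ p →
                    Σ[ π ∈ Permutation′ n ] π ⟨$⟩ˡ x ≡ p × π ⟨$⟩ˡ y ≡ q × π ⟨$⟩ˡ z ≡ r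
triple-transitive {n = n} {x = x} {y} {z} {p} {q} {r} x≢y y≢z z≢x p≢q q≢r r≢p =
  transpose r z₂ ∘ₚ transpose q y₁ ∘ₚ transpose p x , x↦p , y↦q , transpose-left z₂ r
  where
  σ₁ σ₂ σ₃ : Fin n → Fin n
  y₁ z₂ : Fin n
  σ₁ = PC.transpose x p
  y₁ = σ₁ y
  σ₂ = PC.transpose y₁ q
  z₂ = σ₂ (σ₁ z)
  σ₃ = PC.transpose z₂ r
  σ₂σ₁-injective : Injective _≡_ _≡_ (σ₂ ∘ σ₁)
  σ₂σ₁-injective = transpose-injective x p ∘ transpose-injective y₁ q
  σ₂σ₁x≡p : σ₂ (σ₁ x) ≡ p
  σ₂σ₁x≡p = trans (cong σ₂ (transpose-left x p)) (transpose-fixed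
    (λ p≡y₁ → x≢y (transpose-injective x p (trans (transpose-left x p) p≡y₁))) p≢q)
  x↦p : σ₃ (σ₂ (σ₁ x)) ≡ p
  x↦p = trans (cong σ₃ σ₂σ₁x≡p) (transpose-fixed
    (λ p≡z₂ → z≢x (sym (σ₂σ₁-injective (trans σ₂σ₁x≡p p≡z₂)))) (r≢p ∘ sym))
  y↦q : σ₃ (σ₂ y₁) ≡ q
  y↦q = trans (cong σ₃ (transpose-left y₁ q)) (transpose-fixed
    (λ q≡z₂ → y≢z (σ₂σ₁-injective (trans (transpose-left y₁ q) q≡z₂))) q≢r)

sum-cancel : ∀ {m} (f : Fin m → ℤ) → sum f + sum (-_ ∘ f) ≡ 0ℤ
sum-cancel {m} f = begin
  sum f + sum (-_ ∘ f)           ≡⟨ ∑-distrib-+ f (-_ ∘ f) ⟨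
  sum (λ j → f j + - f j)        ≡⟨ sum-cong-≗ (ℤ.+-inverseʳ ∘ f) ⟩
  sum {m} (λ _ → 0ℤ)             ≡⟨ sum-replicate-zero m ⟩
  0ℤ                             ∎

sum-nonneg : ∀ {m} (f : Fin m → ℤ) → (∀ i → 0ℤ ≤ f i) → 0ℤ ≤ sum f
sum-nonneg {zero}  f nonneg = ℤ.+≤+ z≤n
sum-nonneg {suc m} f nonneg = ℤ.+-mono-≤ (nonneg Fin.zero) (sum-nonneg (f ∘ Fin.suc) (nonneg ∘ Fin.suc))

sum-pos : ∀ {m} (f : Fin m → ℤ) → (∀ i → 0ℤ ≤ f i) → ∀ i → 0ℤ < f i → 0ℤ < sum f
sum-pos f nonneg Fin.zero    pos = ℤ.+-mono-<-≤ pos (sum-nonneg (f ∘ Fin.suc) (nonneg ∘ Fin.suc))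
sum-pos f nonneg (Fin.suc i) pos = ℤ.+-mono-≤-< (nonneg Fin.zero) (sum-pos (f ∘ Fin.suc) (nonneg ∘ Fin.suc) i pos)

sum-zero : ∀ {m} (f : Fin m → ℤ) → (∀ i → f i ≡ 0ℤ) → sum f ≡ 0ℤ
sum-zero {m} f f≡0 = trans (sum-cong-≗ f≡0) (sum-replicate-zero m)

pos*pos⇒pos : ∀ {i j} → 0ℤ < i → 0ℤ < j → 0ℤ < i * j
pos*pos⇒pos {i} {j} 0<i 0<j = subst (_< i * j) (ℤ.*-zeroʳ i) (ℤ.*-monoˡ-<-pos i {{ℤ.positive 0<i}} 0<j)

-- Realisable flows

flowSum : List (ChoiceFn n) → Flow n
flowSum []      = 0ᶠ
flowSum (d ∷ L) = flow d ⊕ flowSum L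

flowSum-++ : ∀ (L M : List (ChoiceFn n)) → flowSum (L ++ M) ≐ flowSum L ⊕ flowSum M
flowSum-++ []      M a b = sym (ℤ.+-identityˡ _)
flowSum-++ (d ∷ L) M a b =
  trans (cong (flow d a b +_) (flowSum-++ L M a b)) (sym (ℤ.+-assoc (flow d a b) (flowSum L a b) (flowSum M a b)))

flowSum-act : ∀ π (L : List (ChoiceFn n)) → flowSum (map (act π) L) ≐ relabel π (flowSum L)
flowSum-act π []      a b = refl
flowSum-act π (d ∷ L) a b = cong₂ _+_ (flow-act π d a b) (flowSum-act π L a b)

flowSum-antisym : ∀ {L : List (ChoiceFn n)} → All IsChoice L → Antisymmetric (flowSum L)
flowSum-antisym []                       a b = refl
flowSum-antisym {L = d ∷ L} (isC ∷ isCs) a b =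
  trans (cong₂ _+_ (flow-antisym isC a b) (flowSum-antisym isCs a b)) (sym (ℤ.neg-distrib-+ (flow d b a) (flowSum L b a)))

Realises : (ChoiceFn n → Set) → Flow n → Set
Realises {n} 𝔇 F = Σ[ L ∈ List (ChoiceFn n) ] All 𝔇 L × flowSum L ≐ F

module _ {𝔇 : ChoiceFn n → Set} where

  realises-cong : ∀ {F G} → F ≐ G → Realises 𝔇 F → Realises 𝔇 G
  realises-cong F≐G (L , L⊆𝔇 , sumL≐F) = L , L⊆𝔇 , λ a b → trans (sumL≐F a b) (F≐G a b)

  realises-zero : Realises 𝔇 0ᶠ
  realises-zero = [] , [] , λ _ _ → refl

  realises-flow : ∀ {d} → 𝔇 d → Realises 𝔇 (flow d)
  realises-flow {d} d∈𝔇 = d ∷ [] , d∈𝔇 ∷ [] , λ a b → ℤ.+-identityʳ (flow d a b)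

  realises-⊕ : ∀ {F G} → Realises 𝔇 F → Realises 𝔇 G → Realises 𝔇 (F ⊕ G)
  realises-⊕ (L , L⊆𝔇 , sumL≐F) (M , M⊆𝔇 , sumM≐G) =
    L ++ M , All.++⁺ L⊆𝔇 M⊆𝔇 ,
    λ a b → trans (flowSum-++ L M a b) (cong₂ _+_ (sumL≐F a b) (sumM≐G a b))

  realises-relabel : Symmetric 𝔇 → ∀ π {F} → Realises 𝔇 F → Realises 𝔇 (relabel π F)
  realises-relabel sym𝔇 π (L , L⊆𝔇 , sumL≐F) =
    map (act π) L , All.map⁺ (All.map (sym𝔇 π _) L⊆𝔇) ,
    λ a b → trans (flowSum-act π L a b) (sumL≐F (π ⟨$⟩ˡ a) (π ⟨$⟩ˡ b))

flowSum-images : ∀ {m} (g : Fin m → Permutation′ n) d a b →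
                 flowSum (tabulate (λ j → act (g j) d)) a b ≡ sum (λ j → relabel (g j) (flow d) a b)
flowSum-images {m = zero}  g d a b = refl
flowSum-images {m = suc m} g d a b = cong₂ _+_ (flow-act (g Fin.zero) d a b) (flowSum-images (g ∘ Fin.suc) d a b)

realises-sum : ∀ {𝔇 : ChoiceFn n → Set} {m} {F : Fin m → Flow n} →
               (∀ i → Realises 𝔇 (F i)) → Realises 𝔇 (λ a b → sum (λ i → F i a b))
realises-sum {m = zero}  realised = realises-zero
realises-sum {m = suc m} realised = realises-⊕ (realised Fin.zero) (realises-sum (realised ∘ Fin.suc))

realised-antisym : ∀ {𝔇 : ChoiceFn n → Set} {F} → (∀ d → 𝔇 d → IsChoice d) →
                   Realises 𝔇 F → Antisymmetric F
realised-antisym 𝔇⊆choice (L , L⊆𝔇 , sumL≐F) a b =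
  trans (sym (sumL≐F a b)) (trans (flowSum-antisym (All.map (𝔇⊆choice _) L⊆𝔇) a b) (cong -_ (sumL≐F b a)))

-- Negation through the dihedral group

[m%d+n]%d≡[m+n]%d : ∀ m n d .{{_ : ℕ.NonZero d}} → (m % d ℕ.+ n) % d ≡ (m ℕ.+ n) % d
[m%d+n]%d≡[m+n]%d m n d = begin
  (m % d ℕ.+ n) % d         ≡⟨ %-distribˡ-+ (m % d) n d ⟩
  (m % d % d ℕ.+ n % d) % d ≡⟨ cong (λ x → (x ℕ.+ n % d) % d) (m%n%n≡m%n m d) ⟩
  (m % d ℕ.+ n % d) % d     ≡⟨ %-distribˡ-+ m n d ⟨
  (m ℕ.+ n) % d             ∎

[m+n%d]%d≡[m+n]%d : ∀ m n d .{{_ : ℕ.NonZero d}} → (m ℕ.+ n % d) % d ≡ (m ℕ.+ n) % d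
[m+n%d]%d≡[m+n]%d m n d = begin
  (m ℕ.+ n % d) % d ≡⟨ cong (_% d) (ℕ.+-comm m (n % d)) ⟩
  (n % d ℕ.+ m) % d ≡⟨ [m%d+n]%d≡[m+n]%d n m d ⟩
  (n ℕ.+ m) % d     ≡⟨ cong (_% d) (ℕ.+-comm n m) ⟩
  (m ℕ.+ n) % d     ∎

module Dihedral (k : ℕ) where

  rotate : ℕ → Fin (suc k) → Fin (suc k)
  rotate i a = (toℕ a ℕ.+ i) mod suc k

  toℕ-rotate : ∀ i a → toℕ (rotate i a) ≡ (toℕ a ℕ.+ i) % suc k
  toℕ-rotate i a = Fin.toℕ-fromℕ< _

  rotate-cong : ∀ i a j b → (toℕ a ℕ.+ i) % suc k ≡ (toℕ b ℕ.+ j) % suc k → rotate i a ≡ rotate j b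
  rotate-cong i a j b eq = Fin.toℕ-injective (trans (toℕ-rotate i a) (trans eq (sym (toℕ-rotate j b))))

  rotate-rotate : ∀ i j a → rotate j (rotate i a) ≡ rotate (i ℕ.+ j) a
  rotate-rotate i j a = rotate-cong j (rotate i a) (i ℕ.+ j) a (begin
    (toℕ (rotate i a) ℕ.+ j) % suc k   ≡⟨ cong (λ x → (x ℕ.+ j) % suc k) (toℕ-rotate i a) ⟩
    ((toℕ a ℕ.+ i) % suc k ℕ.+ j) % suc k ≡⟨ [m%d+n]%d≡[m+n]%d (toℕ a ℕ.+ i) j (suc k) ⟩
    (toℕ a ℕ.+ i ℕ.+ j) % suc k        ≡⟨ cong (_% suc k) (ℕ.+-assoc (toℕ a) i j) ⟩
    (toℕ a ℕ.+ (i ℕ.+ j)) % suc k      ∎)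

  rotate-multiple : ∀ t a → rotate (t ℕ.* suc k) a ≡ a
  rotate-multiple t a = Fin.toℕ-injective (begin
    toℕ (rotate (t ℕ.* suc k) a)       ≡⟨ toℕ-rotate (t ℕ.* suc k) a ⟩
    (toℕ a ℕ.+ t ℕ.* suc k) % suc k    ≡⟨ [m+kn]%n≡m%n (toℕ a) t (suc k) ⟩
    toℕ a % suc k                      ≡⟨ m<n⇒m%n≡m (Fin.toℕ<n a) ⟩
    toℕ a                              ∎)

  rotate-inverse : ∀ i j t → i ℕ.+ j ≡ t ℕ.* suc k → ∀ a → rotate j (rotate i a) ≡ a
  rotate-inverse i j t i+j≡tN a =
    trans (rotate-rotate i j a) (trans (cong (λ x → rotate x a) i+j≡tN) (rotate-multiple t a))

  rotationBy : ℕ → Permutation′ (suc k)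
  rotationBy i = Perm.permutation (rotate (i ℕ.* k)) (rotate i)
    (rotate-inverse i (i ℕ.* k) i (sym (ℕ.*-suc i k)))
    (rotate-inverse (i ℕ.* k) i i (trans (ℕ.+-comm (i ℕ.* k) i) (sym (ℕ.*-suc i k))))

  rotation reflection : Fin (suc k) → Permutation′ (suc k)
  rotation = rotationBy ∘ toℕ
  reflection j = rotation j ∘ₚ Perm.reverse

  opposite-+ : ∀ a → toℕ (opposite a) ℕ.+ toℕ a ≡ k
  opposite-+ a = trans (cong (ℕ._+ toℕ a) (Fin.opposite-prop a)) (ℕ.m∸n+n≡m (ℕ.≤-pred (Fin.toℕ<n a)))

  -- Reindexing the reflections by a + b + 1 turns the image of (a, b) into that of (b, a) under a rotation.
  reflect-shift : ∀ a b j → rotate (toℕ (rotate (suc (toℕ a ℕ.+ toℕ b)) j)) (opposite a) ≡ rotate (toℕ j) b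
  reflect-shift a b j = rotate-cong (toℕ (rotate s j)) (opposite a) (toℕ j) b (begin
    (toℕ (opposite a) ℕ.+ toℕ (rotate s j)) % suc k
      ≡⟨ cong (λ x → (toℕ (opposite a) ℕ.+ x) % suc k) (toℕ-rotate s j) ⟩
    (toℕ (opposite a) ℕ.+ (toℕ j ℕ.+ s) % suc k) % suc k
      ≡⟨ [m+n%d]%d≡[m+n]%d (toℕ (opposite a)) (toℕ j ℕ.+ s) (suc k) ⟩
    (toℕ (opposite a) ℕ.+ (toℕ j ℕ.+ s)) % suc k
      ≡⟨ cong (_% suc k) (shift (toℕ (opposite a)) (toℕ a) (toℕ b) (toℕ j)) ⟩
    (toℕ b ℕ.+ toℕ j ℕ.+ suc (toℕ (opposite a) ℕ.+ toℕ a)) % suc k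
      ≡⟨ cong (λ x → (toℕ b ℕ.+ toℕ j ℕ.+ suc x) % suc k) (opposite-+ a) ⟩
    (toℕ b ℕ.+ toℕ j ℕ.+ suc k) % suc k
      ≡⟨ [m+n]%n≡m%n (toℕ b ℕ.+ toℕ j) (suc k) ⟩
    (toℕ b ℕ.+ toℕ j) % suc k ∎)
    where
    s : ℕ
    s = suc (toℕ a ℕ.+ toℕ b)
    shift : ∀ u a b j → u ℕ.+ (j ℕ.+ suc (a ℕ.+ b)) ≡ b ℕ.+ j ℕ.+ suc (u ℕ.+ a)
    shift = ℕ-Solver.solve-∀

  dihedral-balance : ∀ {h : Flow (suc k)} → Antisymmetric h → ∀ a b →
    sum (λ j → relabel (rotation j) h a b) + sum (λ j → relabel (reflection j) h a b) ≡ 0ℤ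
  dihedral-balance {h} anti a b = begin
    sum R + sum P         ≡⟨ cong (sum R +_) P≡-R ⟩
    sum R + sum (-_ ∘ R)  ≡⟨ sum-cancel R ⟩
    0ℤ                    ∎
    where
    R R⁻ P : Fin (suc k) → ℤ
    R j = h (rotate (toℕ j) a) (rotate (toℕ j) b)
    R⁻ j = h (rotate (toℕ j) b) (rotate (toℕ j) a)
    P j = h (rotate (toℕ j) (opposite a)) (rotate (toℕ j) (opposite b))
    s : ℕ
    s = suc (toℕ a ℕ.+ toℕ b)
    reflect-shift′ : ∀ j → rotate (toℕ (rotate s j)) (opposite b) ≡ rotate (toℕ j) a
    reflect-shift′ j = subst (λ x → rotate (toℕ (rotate (suc x) j)) (opposite b) ≡ rotate (toℕ j) a)
                             (ℕ.+-comm (toℕ b) (toℕ a)) (reflect-shift b a j)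
    P≡-R : sum P ≡ sum (-_ ∘ R)
    P≡-R = begin
      sum P                ≡⟨ sum-permute P (Perm.flip (rotationBy s)) ⟩
      sum (P ∘ rotate s)   ≡⟨ sum-cong-≗ {suc k} (λ j → cong₂ h (reflect-shift a b j) (reflect-shift′ j)) ⟩
      sum R⁻               ≡⟨ sum-cong-≗ {suc k} (λ j → anti (rotate (toℕ j) b) (rotate (toℕ j) a)) ⟩
      sum (-_ ∘ R)         ∎

  -- The dihedral orbit of d without its identity term act (rotation 0) d.
  reversal : ChoiceFn (suc k) → List (ChoiceFn (suc k))
  reversal d = tabulate (λ j → act (rotation (Fin.suc j)) d) ++ tabulate (λ j → act (reflection j) d)

  flowSum-reversal : ∀ {d} → IsChoice d → flowSum (reversal d) ≐ ⊖ flow d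
  flowSum-reversal {d} isC a b = inverseʳ-unique (flow d a b) (flowSum (reversal d) a b) (begin
    flow d a b + flowSum (reversal d) a b  ≡⟨ cong (_+ flowSum (reversal d) a b) rotation-0 ⟨
    flowSum orbit a b                      ≡⟨ orbit-flow-zero ⟩
    0ℤ                                     ∎)
    where
    rotation-0 : flow (act (rotation Fin.zero) d) a b ≡ flow d a b
    rotation-0 = trans (flow-act (rotation Fin.zero) d a b) (cong₂ (flow d) (rotate-multiple 0 a) (rotate-multiple 0 b))
    orbit : List (ChoiceFn (suc k))
    orbit = act (rotation Fin.zero) d ∷ reversal d
    orbit-flow-zero : flowSum orbit a b ≡ 0ℤ
    orbit-flow-zero = begin
      flowSum (tabulate (λ j → act (rotation j) d) ++ tabulate (λ j → act (reflection j) d)) a b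
        ≡⟨ flowSum-++ (tabulate (λ j → act (rotation j) d)) (tabulate (λ j → act (reflection j) d)) a b ⟩
      flowSum (tabulate (λ j → act (rotation j) d)) a b + flowSum (tabulate (λ j → act (reflection j) d)) a b
        ≡⟨ cong₂ _+_ (flowSum-images rotation d a b) (flowSum-images reflection d a b) ⟩
      sum (λ j → relabel (rotation j) (flow d) a b) + sum (λ j → relabel (reflection j) (flow d) a b)
        ≡⟨ dihedral-balance (flow-antisym isC) a b ⟩
      0ℤ ∎

module _ {k} {𝔇 : ChoiceFn (suc k) → Set} (sym𝔇 : Symmetric 𝔇) (𝔇⊆choice : ∀ d → 𝔇 d → IsChoice d) where
  open Dihedral k

  realises-⊖flow : ∀ {d} → 𝔇 d → Realises 𝔇 (⊖ flow d)
  realises-⊖flow {d} d∈𝔇 =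
    reversal d ,
    All.++⁺ (All.tabulate⁺ (λ j → sym𝔇 (rotation (Fin.suc j)) d d∈𝔇))
            (All.tabulate⁺ (λ j → sym𝔇 (reflection j) d d∈𝔇)) ,
    flowSum-reversal (𝔇⊆choice d d∈𝔇)

  realises-⊖ : ∀ {F} → Realises 𝔇 F → Realises 𝔇 (⊖ F)
  realises-⊖ (L , L⊆𝔇 , sumL≐F) = realises-cong (λ a b → cong -_ (sumL≐F a b)) (negate L⊆𝔇)
    where
    negate : ∀ {L} → All 𝔇 L → Realises 𝔇 (⊖ flowSum L)
    negate [] = realises-zero
    negate {d ∷ L} (d∈𝔇 ∷ L⊆𝔇) =
      realises-cong (λ a b → sym (ℤ.neg-distrib-+ (flow d a b) (flowSum L a b)))
                    (realises-⊕ (realises-⊖flow d∈𝔇) (negate L⊆𝔇))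

  nonempty-realisation : ∀ {d F} → 𝔇 d → Realises 𝔇 F →
                         Σ[ L ∈ List (ChoiceFn (suc k)) ] All 𝔇 (d ∷ L) × flowSum (d ∷ L) ≐ F
  nonempty-realisation {d} {F} d∈𝔇 realised = prefix (realises-⊕ (realises-⊖flow d∈𝔇) realised)
    where
    cancel : ∀ x y → x + (- x + y) ≡ y
    cancel = solve-∀
    prefix : Realises 𝔇 (⊖ flow d ⊕ F) → Σ[ L ∈ List (ChoiceFn (suc k)) ] All 𝔇 (d ∷ L) × flowSum (d ∷ L) ≐ F
    prefix (L , L⊆𝔇 , sumL≐-d+F) =
      L , d∈𝔇 ∷ L⊆𝔇 , λ a b → trans (cong (flow d a b +_) (sumL≐-d+F a b)) (cancel (flow d a b) (F a b))

-- Triangles from the alternating sum over three points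

sum-of-three-units≢0 : ∀ {x y z} → x ≡ 1ℤ ⊎ x ≡ -1ℤ → y ≡ 1ℤ ⊎ y ≡ -1ℤ → z ≡ 1ℤ ⊎ z ≡ -1ℤ →
                       x + y + z ≢ 0ℤ
sum-of-three-units≢0 (inj₁ refl) (inj₁ refl) (inj₁ refl) ()
sum-of-three-units≢0 (inj₁ refl) (inj₁ refl) (inj₂ refl) ()
sum-of-three-units≢0 (inj₁ refl) (inj₂ refl) (inj₁ refl) ()
sum-of-three-units≢0 (inj₁ refl) (inj₂ refl) (inj₂ refl) ()
sum-of-three-units≢0 (inj₂ refl) (inj₁ refl) (inj₁ refl) ()
sum-of-three-units≢0 (inj₂ refl) (inj₁ refl) (inj₂ refl) ()
sum-of-three-units≢0 (inj₂ refl) (inj₂ refl) (inj₁ refl) ()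
sum-of-three-units≢0 (inj₂ refl) (inj₂ refl) (inj₂ refl) ()

module Alternating (m : ℕ) where

  τ₀₁ τ₁₂ τ₀₂ γ γ² : Permutation′ (3 ℕ.+ m)
  τ₀₁ = transpose 0F 1F
  τ₁₂ = transpose 1F 2F
  τ₀₂ = transpose 0F 2F
  γ   = τ₀₁ ∘ₚ τ₁₂
  γ²  = τ₁₂ ∘ₚ τ₀₁

  evenPart oddPart alternating : Flow (3 ℕ.+ m) → Flow (3 ℕ.+ m)
  evenPart h    = h ⊕ relabel γ h ⊕ relabel γ² h
  oddPart h     = relabel τ₀₁ h ⊕ relabel τ₁₂ h ⊕ relabel τ₀₂ h
  alternating h = evenPart h ⊕ ⊖ oddPart h

  circulation : Flow (3 ℕ.+ m) → ℤ
  circulation h = h 0F 1F + h 1F 2F + h 2F 0F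

  orbit-balance : ∀ (g : Fin (3 ℕ.+ m) → ℤ) u →
    g u + g (γ ⟨$⟩ˡ u) + g (γ² ⟨$⟩ˡ u) ≡ g (τ₀₁ ⟨$⟩ˡ u) + g (τ₁₂ ⟨$⟩ˡ u) + g (τ₀₂ ⟨$⟩ˡ u)
  orbit-balance g 0F = swap₁₂ (g 0F) (g 1F) (g 2F)
    where swap₁₂ : ∀ x y z → x + y + z ≡ y + x + z
          swap₁₂ = solve-∀
  orbit-balance g 1F = swap₁₃ (g 1F) (g 2F) (g 0F)
    where swap₁₃ : ∀ x y z → x + y + z ≡ z + y + x
          swap₁₃ = solve-∀
  orbit-balance g 2F = swap₂₃ (g 2F) (g 0F) (g 1F)
    where swap₂₃ : ∀ x y z → x + y + z ≡ x + z + y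
          swap₂₃ = solve-∀
  orbit-balance g (Fin.suc (Fin.suc (Fin.suc _))) = refl

  alternating-antisym : ∀ {h} → Antisymmetric h → Antisymmetric (alternating h)
  alternating-antisym anti =
    ⊕-antisym (⊕-antisym (⊕-antisym anti (relabel-antisym γ anti)) (relabel-antisym γ² anti))
              (⊖-antisym (⊕-antisym (⊕-antisym (relabel-antisym τ₀₁ anti) (relabel-antisym τ₁₂ anti))
                                    (relabel-antisym τ₀₂ anti)))

  i≡j⇒i-j≡k*0 : ∀ k {i j} → i ≡ j → i - j ≡ k * 0ℤ
  i≡j⇒i-j≡k*0 k {i} refl = trans (ℤ.+-inverseʳ i) (sym (ℤ.*-zeroʳ k))

  alternating-swap : ∀ {h} → Antisymmetric h → ∀ a b k →
                     alternating h a b ≡ k * 1ℤ → alternating h b a ≡ k * -1ℤ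
  alternating-swap {h} anti a b k eq = begin
    alternating h b a    ≡⟨ alternating-antisym anti b a ⟩
    - alternating h a b  ≡⟨ cong -_ eq ⟩
    - (k * 1ℤ)           ≡⟨ ℤ.neg-distribʳ-* k 1ℤ ⟩
    k * -1ℤ              ∎

  alternating-triangle : ∀ {h} → Antisymmetric h →
                         alternating h ≐ (circulation h + circulation h) · triangle 0F 1F 2F
  alternating-triangle {h} anti = pointwise
    where
    K : ℤ
    K = circulation h + circulation h
    pointwise : alternating h ≐ K · triangle 0F 1F 2F
    pointwise 0F 0F = i≡j⇒i-j≡k*0 K (orbit-balance (λ u → h u u) 0F)
    pointwise 1F 1F = i≡j⇒i-j≡k*0 K (orbit-balance (λ u → h u u) 1F)
    pointwise 2F 2F = i≡j⇒i-j≡k*0 K (orbit-balance (λ u → h u u) 2F)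
    pointwise 0F 1F rewrite anti 1F 0F | anti 0F 2F | anti 2F 1F = cyclic (h 0F 1F) (h 1F 2F) (h 2F 0F)
      where cyclic : ∀ x y z → x + y + z - (- x + - z + - y) ≡ (x + y + z + (x + y + z)) * 1ℤ
            cyclic = solve-∀
    pointwise 1F 2F rewrite anti 1F 0F | anti 0F 2F | anti 2F 1F = cyclic (h 0F 1F) (h 1F 2F) (h 2F 0F)
      where cyclic : ∀ x y z → y + z + x - (- z + - y + - x) ≡ (x + y + z + (x + y + z)) * 1ℤ
            cyclic = solve-∀
    pointwise 2F 0F rewrite anti 1F 0F | anti 0F 2F | anti 2F 1F = cyclic (h 0F 1F) (h 1F 2F) (h 2F 0F)
      where cyclic : ∀ x y z → z + x + y - (- y + - x + - z) ≡ (x + y + z + (x + y + z)) * 1ℤ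
            cyclic = solve-∀
    pointwise 1F 0F = alternating-swap anti 0F 1F K (pointwise 0F 1F)
    pointwise 2F 1F = alternating-swap anti 1F 2F K (pointwise 1F 2F)
    pointwise 0F 2F = alternating-swap anti 2F 0F K (pointwise 2F 0F)
    pointwise a@(Fin.suc (Fin.suc (Fin.suc _))) b = i≡j⇒i-j≡k*0 K (orbit-balance (h a) b)
    pointwise 0F b@(Fin.suc (Fin.suc (Fin.suc _))) = i≡j⇒i-j≡k*0 K (orbit-balance (λ u → h u b) 0F)
    pointwise 1F b@(Fin.suc (Fin.suc (Fin.suc _))) = i≡j⇒i-j≡k*0 K (orbit-balance (λ u → h u b) 1F)
    pointwise 2F b@(Fin.suc (Fin.suc (Fin.suc _))) = i≡j⇒i-j≡k*0 K (orbit-balance (λ u → h u b) 2F)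

module _ {m} {𝔇 : ChoiceFn (3 ℕ.+ m) → Set} (sym𝔇 : Symmetric 𝔇) (𝔇⊆choice : ∀ d → 𝔇 d → IsChoice d)
  where
  open Alternating m

  realises-alternating : ∀ {d} → 𝔇 d → Realises 𝔇 (alternating (flow d))
  realises-alternating {d} d∈𝔇 = realises-⊕ even (realises-⊖ sym𝔇 𝔇⊆choice odd)
    where
    image : ∀ π → Realises 𝔇 (relabel π (flow d))
    image π = realises-relabel sym𝔇 π (realises-flow d∈𝔇)
    even : Realises 𝔇 (evenPart (flow d))
    even = realises-⊕ (realises-⊕ (realises-flow d∈𝔇) (image γ)) (image γ²)
    odd : Realises 𝔇 (oddPart (flow d))
    odd = realises-⊕ (realises-⊕ (image τ₀₁) (image τ₁₂)) (image τ₀₂)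

  realises-2σ·triangle : ∀ {d} → 𝔇 d →
                         Realises 𝔇 ((circulation (flow d) + circulation (flow d)) · triangle 0F 1F 2F)
  realises-2σ·triangle {d} d∈𝔇 =
    realises-cong (alternating-triangle (flow-antisym (𝔇⊆choice d d∈𝔇))) (realises-alternating d∈𝔇)

  realises-triangle₀₁₂ : ∀ {d} → 𝔇 d → IsFullChoice d →
                         Σ[ K ∈ ℤ ] 0ℤ < K × Realises 𝔇 (K · triangle 0F 1F 2F)
  realises-triangle₀₁₂ {d} d∈𝔇 full with ℤ.<-cmp 0ℤ (circulation (flow d))
  ... | tri< 0<σ _ _ = _ , ℤ.+-mono-< 0<σ 0<σ , realises-2σ·triangle d∈𝔇
  ... | tri≈ _ 0≡σ _ =
    ⊥-elim (sum-of-three-units≢0 (flow-unit full λ ()) (flow-unit full λ ()) (flow-unit full λ ()) (sym 0≡σ))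
  ... | tri> _ _ σ<0 = _ , ℤ.neg-mono-< (ℤ.+-mono-< σ<0 σ<0) ,
    realises-cong (λ a b → ℤ.neg-distribˡ-* (circulation (flow d) + circulation (flow d)) (triangle 0F 1F 2F a b))
                  (realises-⊖ sym𝔇 𝔇⊆choice (realises-2σ·triangle d∈𝔇))

realises-degenerate-triangle : ∀ {𝔇 : ChoiceFn n → Set} K {x y z} → x ≡ y ⊎ y ≡ z ⊎ z ≡ x →
                               Realises 𝔇 (K · triangle x y z)
realises-degenerate-triangle K {x} {y} {z} coincide =
  realises-cong (λ a b → sym (trans (cong (K *_) (triangle-degenerate x y z coincide a b)) (ℤ.*-zeroʳ K)))
                realises-zero

module _ {𝔇 : ChoiceFn n → Set} (sym𝔇 : Symmetric 𝔇) {K : ℤ} {p q r : Fin n}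
         (p≢q : p ≢ q) (q≢r : q ≢ r) (r≢p : r ≢ p) (base : Realises 𝔇 (K · triangle p q r)) where

  realises-triangle : ∀ x y z → Realises 𝔇 (K · triangle x y z)
  realises-triangle x y z with x ≟ y | y ≟ z | z ≟ x
  ... | yes x≡y | _       | _       = realises-degenerate-triangle K (inj₁ x≡y)
  ... | no _    | yes y≡z | _       = realises-degenerate-triangle K (inj₂ (inj₁ y≡z))
  ... | no _    | no _    | yes z≡x = realises-degenerate-triangle K (inj₂ (inj₂ z≡x))
  ... | no x≢y  | no y≢z  | no z≢x  with triple-transitive x≢y y≢z z≢x p≢q q≢r r≢p
  ...   | π , x↦p , y↦q , z↦r = realises-cong moved (realises-relabel sym𝔇 π base)
    where
    moved : relabel π (K · triangle p q r) ≐ K · triangle x y z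
    moved a b rewrite sym x↦p | sym y↦q | sym z↦r =
      cong (K *_) (triangle-injective (permutation-injectiveˡ π) x y z a b)

-- Cycles of Tor[c]

pathFlow : ∀ {R : Fin n → Fin n → Set} {u v} → Star R u v → Flow n
pathFlow ε                  = 0ᶠ
pathFlow (_◅_ {i} {j} _ w) = edge i j ⊕ pathFlow w

module _ {𝔇 : ChoiceFn n → Set} {K : ℤ} (triangles : ∀ x y z → Realises 𝔇 (K · triangle x y z)) where

  -- Coning a path off from an apex o: the inner sides of consecutive triangles cancel.
  realises-fan : ∀ {R} o {u v} (w : Star R u v) → Realises 𝔇 (K · (edge o u ⊕ pathFlow w ⊕ edge v o))
  realises-fan o {u} ε = realises-cong closes realises-zero
    where
    closes : 0ᶠ ≐ K · (edge o u ⊕ 0ᶠ ⊕ edge u o)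
    closes a b rewrite edge-swap o u a b = cancel K (edge o u a b)
      where cancel : ∀ k x → 0ℤ ≡ k * (x + 0ℤ + - x)
            cancel = solve-∀
  realises-fan o {v = v} (_◅_ {i} {j} _ w) = realises-cong telescopes (realises-⊕ (triangles o i j) (realises-fan o w))
    where
    telescopes : K · triangle o i j ⊕ K · (edge o j ⊕ pathFlow w ⊕ edge v o) ≐
                 K · (edge o i ⊕ (edge i j ⊕ pathFlow w) ⊕ edge v o)
    telescopes a b rewrite edge-swap o j a b =
      telescope K (edge o i a b) (edge i j a b) (edge o j a b) (pathFlow w a b) (edge v o a b)
      where telescope : ∀ k x y z p q → k * (x + y + - z) + k * (z + p + q) ≡ k * (x + (y + p) + q)
            telescope = solve-∀

  realises-cycle : ∀ {R u} (w : Star R u u) → Realises 𝔇 (K · pathFlow w)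
  realises-cycle {u = u} w = realises-cong (λ a b → cong (K *_) (closes a b)) (realises-fan u w)
    where
    closes : edge u u ⊕ pathFlow w ⊕ edge u u ≐ pathFlow w
    closes a b rewrite edge-diag u a b = trans (ℤ.+-identityʳ _) (ℤ.+-identityˡ _)

torEdge? : ∀ (c : ChoiceFn n) x y → Dec (TorEdge c x y)
torEdge? c x y = ¬? (x ≟ y) ×-dec Maybe.≡-dec _≟_ (c x y) (just y)

undefined-not-arc : ∀ {c : ChoiceFn n} {a b p q} → c a b ≡ nothing → TorEdge c p q → ¬ (a ≡ p × b ≡ q)
undefined-not-arc cab≡nothing (_ , cab≡b) (refl , refl) with trans (sym cab≡nothing) cab≡b
... | ()

module _ {c : ChoiceFn n} (isC : IsChoice c) where

  arc-not-reversed : ∀ {a b p q} → TorEdge c a b → TorEdge c p q → ¬ (a ≡ q × b ≡ p)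
  arc-not-reversed (a≢b , cab≡b) (_ , cba≡a) (refl , refl) =
    a≢b (sym (Maybe.just-injective (trans (sym cab≡b) (trans (IsChoice.unord isC _ _) cba≡a))))

  undefined-not-reversed-arc : ∀ {a b p q} → c a b ≡ nothing → TorEdge c p q → ¬ (a ≡ q × b ≡ p)
  undefined-not-reversed-arc cab≡nothing (_ , cba≡a) (refl , refl)
    with trans (sym cab≡nothing) (trans (IsChoice.unord isC _ _) cba≡a)
  ... | ()

  pathFlow-nonneg : ∀ {a b u v} → TorEdge c a b → (w : Star (TorEdge c) u v) → 0ℤ ≤ pathFlow w a b
  pathFlow-nonneg ab ε       = ℤ.+≤+ z≤n
  pathFlow-nonneg ab (e ◅ w) = ℤ.+-mono-≤ (edge-nonneg (arc-not-reversed ab e)) (pathFlow-nonneg ab w)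

  pathFlow-undefined : ∀ {a b u v} → c a b ≡ nothing → (w : Star (TorEdge c) u v) → pathFlow w a b ≡ 0ℤ
  pathFlow-undefined undef ε       = refl
  pathFlow-undefined undef (e ◅ w) =
    cong₂ _+_ (edge-zero (undefined-not-arc undef e) (undefined-not-reversed-arc undef e)) (pathFlow-undefined undef w)

  cycle-positive : ∀ {a b} (e : TorEdge c a b) (w : Star (TorEdge c) b a) → 0ℤ < pathFlow (e ◅ w) a b
  cycle-positive e w = subst (λ x → 0ℤ < x + pathFlow w _ _) (sym (edge-self (proj₁ e)))
                             (ℤ.+-mono-<-≤ (ℤ.+<+ z<s) (pathFlow-nonneg e w))

record Induces (F : Flow n) (c : ChoiceFn n) : Set where
  field
    arc⇒positive          : ∀ {a b} → TorEdge c a b → 0ℤ < F a b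
    reversed-arc⇒negative : ∀ {a b} → TorEdge c b a → F a b < 0ℤ
    undefined⇒zero        : ∀ {a b} → c a b ≡ nothing → F a b ≡ 0ℤ

module _ {c : ChoiceFn n} (pb : PseudoBalanced c) where

  cycleThrough : ∀ {x y} → Dec (TorEdge c x y) → Flow n
  cycleThrough (yes e) = pathFlow (e ◅ pb _ _ e)
  cycleThrough (no  _) = 0ᶠ

  cycleSum : Flow n
  cycleSum a b = sum (λ x → sum (λ y → cycleThrough (torEdge? c x y) a b))

  realises-cycleSum : ∀ {𝔇 : ChoiceFn n → Set} {K} → (∀ x y z → Realises 𝔇 (K · triangle x y z)) →
                      Realises 𝔇 (K · cycleSum)
  realises-cycleSum {𝔇} {K} triangles =
    realises-cong (λ a b → sym (distrib a b))
      (realises-sum (λ x → realises-sum (λ y → realises-cycleThrough (torEdge? c x y))))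
    where
    realises-cycleThrough : ∀ {x y} (e? : Dec (TorEdge c x y)) → Realises 𝔇 (K · cycleThrough e?)
    realises-cycleThrough (yes e) = realises-cycle {K = K} triangles (e ◅ pb _ _ e)
    realises-cycleThrough (no  _) = realises-cong (λ _ _ → sym (ℤ.*-zeroʳ K)) realises-zero
    distrib : ∀ a b → K * cycleSum a b ≡ sum (λ x → sum (λ y → K * cycleThrough (torEdge? c x y) a b))
    distrib a b = trans (*-distribˡ-sum K (λ x → sum (λ y → cycleThrough (torEdge? c x y) a b)))
                        (sum-cong-≗ (λ x → *-distribˡ-sum K (λ y → cycleThrough (torEdge? c x y) a b)))

  module _ (isC : IsChoice c) where

    cycleThrough-nonneg : ∀ {a b x y} → TorEdge c a b → (e? : Dec (TorEdge c x y)) → 0ℤ ≤ cycleThrough e? a b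
    cycleThrough-nonneg ab (yes e) = pathFlow-nonneg isC ab (e ◅ pb _ _ e)
    cycleThrough-nonneg ab (no  _) = ℤ.≤-refl

    cycleThrough-own : ∀ {a b} → TorEdge c a b → (e? : Dec (TorEdge c a b)) → 0ℤ < cycleThrough e? a b
    cycleThrough-own ab (yes e)  = cycle-positive isC e (pb _ _ e)
    cycleThrough-own ab (no ¬ab) = ⊥-elim (¬ab ab)

    cycleThrough-undefined : ∀ {a b x y} → c a b ≡ nothing → (e? : Dec (TorEdge c x y)) → cycleThrough e? a b ≡ 0ℤ
    cycleThrough-undefined undef (yes e) = pathFlow-undefined isC undef (e ◅ pb _ _ e)
    cycleThrough-undefined undef (no  _) = refl

    cycleSum-positive : ∀ {a b} → TorEdge c a b → 0ℤ < cycleSum a b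
    cycleSum-positive {a} {b} ab =
      sum-pos _ (λ x → sum-nonneg _ (λ y → cycleThrough-nonneg ab (torEdge? c x y))) a
        (sum-pos _ (λ y → cycleThrough-nonneg ab (torEdge? c a y)) b (cycleThrough-own ab (torEdge? c a b)))

    cycleSum-undefined : ∀ {a b} → c a b ≡ nothing → cycleSum a b ≡ 0ℤ
    cycleSum-undefined undef = sum-zero _ (λ x → sum-zero _ (λ y → cycleThrough-undefined undef (torEdge? c x y)))

    cycleSum-induces : ∀ {𝔇 : ChoiceFn n → Set} {K} → (∀ d → 𝔇 d → IsChoice d) → 0ℤ < K →
                       Realises 𝔇 (K · cycleSum) → Induces (K · cycleSum) c
    cycleSum-induces {K = K} 𝔇⊆choice 0<K realised = record
      { arc⇒positive          = λ ab → pos*pos⇒pos 0<K (cycleSum-positive ab)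
      ; reversed-arc⇒negative = λ {a} {b} ba → subst (_< 0ℤ) (sym (realised-antisym 𝔇⊆choice realised a b))
                                                  (ℤ.neg-mono-< (pos*pos⇒pos 0<K (cycleSum-positive ba)))
      ; undefined⇒zero        = λ undef → trans (cong (K *_) (cycleSum-undefined undef)) (ℤ.*-zeroʳ K)
      }

-- From flows to the majority closure

ι : ℤ → ℚ
ι z = mkℚ z 0 (Coprimality.sym (1-coprimeTo ℤ.∣ z ∣))

ι-+ : ∀ x y → ι (x + y) ≡ ι x ℚ.+ ι y
ι-+ x y =
  ℚ.toℚᵘ-injective (ℚᵘ.≃-trans (ℚᵘ.*≡* (unit-denominators x y)) (ℚᵘ.≃-sym (ℚ.toℚᵘ-homo-+ (ι x) (ι y))))
  where
  unit-denominators : ∀ x y → (x + y) * 1ℤ ≡ (x * 1ℤ + y * 1ℤ) * 1ℤ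
  unit-denominators = solve-∀

ι-mono-< : ∀ {x y} → x < y → ι x ℚ.< ι y
ι-mono-< {x} {y} x<y = ℚ.*<* (subst₂ _<_ (sym (ℤ.*-identityʳ x)) (sym (ℤ.*-identityʳ y)) x<y)

tvec-ι : ∀ (d : ChoiceFn n) a b → tvec d a b ≡ ½ ℚ.* ι (1ℤ + flow d a b)
tvec-ι d a b with d a b
... | nothing = refl
... | just z with z ≟ b
...   | yes _ = refl
...   | no  _ = refl

uniform : ℚ → List (ChoiceFn n) → List (ℚ × ChoiceFn n)
uniform w = map (w ,_)

weightSum-uniform : ∀ w (L : List (ChoiceFn n)) → weightSum (uniform w L) ≡ w ℚ.* ι (ℤ.+ length L)
weightSum-uniform w []      = sym (ℚ.*-zeroʳ w)
weightSum-uniform w (d ∷ L) = begin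
  w ℚ.+ weightSum (uniform w L)             ≡⟨ cong₂ ℚ._+_ (sym (ℚ.*-identityʳ w)) (weightSum-uniform w L) ⟩
  w ℚ.* 1ℚ ℚ.+ w ℚ.* ι (ℤ.+ length L)      ≡⟨ ℚ.*-distribˡ-+ w 1ℚ (ι (ℤ.+ length L)) ⟨
  w ℚ.* (1ℚ ℚ.+ ι (ℤ.+ length L))          ≡⟨ cong (w ℚ.*_) (ι-+ 1ℤ (ℤ.+ length L)) ⟨
  w ℚ.* ι (ℤ.+ length (d ∷ L))              ∎

combo-uniform : ∀ w (L : List (ChoiceFn n)) a b →
                combo (uniform w L) a b ≡ w ℚ.* (½ ℚ.* ι (ℤ.+ length L + flowSum L a b))
combo-uniform w []      a b = sym (ℚ.*-zeroʳ w)
combo-uniform w (d ∷ L) a b = begin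
  w ℚ.* tvec d a b ℚ.+ combo (uniform w L) a b
    ≡⟨ cong₂ (λ x y → w ℚ.* x ℚ.+ y) (tvec-ι d a b) (combo-uniform w L a b) ⟩
  w ℚ.* (½ ℚ.* ι (1ℤ + f)) ℚ.+ w ℚ.* (½ ℚ.* ι (l + F))
    ≡⟨ ℚ.*-distribˡ-+ w (½ ℚ.* ι (1ℤ + f)) (½ ℚ.* ι (l + F)) ⟨
  w ℚ.* (½ ℚ.* ι (1ℤ + f) ℚ.+ ½ ℚ.* ι (l + F))
    ≡⟨ cong (w ℚ.*_) (ℚ.*-distribˡ-+ ½ (ι (1ℤ + f)) (ι (l + F))) ⟨
  w ℚ.* (½ ℚ.* (ι (1ℤ + f) ℚ.+ ι (l + F)))
    ≡⟨ cong (λ x → w ℚ.* (½ ℚ.* x)) (ι-+ (1ℤ + f) (l + F)) ⟨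
  w ℚ.* (½ ℚ.* ι (1ℤ + f + (l + F)))
    ≡⟨ cong (λ x → w ℚ.* (½ ℚ.* ι x)) (regroup f l F) ⟩
  w ℚ.* (½ ℚ.* ι (1ℤ + l + (f + F)))        ∎
  where
  f l F : ℤ
  f = flow d a b
  l = ℤ.+ length L
  F = flowSum L a b
  regroup : ∀ f l F → 1ℤ + f + (l + F) ≡ 1ℤ + l + (f + F)
  regroup = solve-∀

module _ (t : Fin n → Fin n → ℚ) (x y : Fin n) where

  maj-above : x ≢ y → ½ ℚ.< t x y → maj t x y ≡ just y
  maj-above x≢y ½<t with x ≟ y
  ... | yes x≡y = ⊥-elim (x≢y x≡y)
  ... | no _ with ½ ℚ.<? t x y
  ...   | yes _  = refl
  ...   | no ½≮t = ⊥-elim (½≮t ½<t)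

  maj-below : x ≢ y → t x y ℚ.< ½ → maj t x y ≡ just x
  maj-below x≢y t<½ with x ≟ y
  ... | yes x≡y = ⊥-elim (x≢y x≡y)
  ... | no _ with ½ ℚ.<? t x y
  ...   | yes ½<t = ⊥-elim (ℚ.<-asym ½<t t<½)
  ...   | no _ with t x y ℚ.<? ½
  ...     | yes _  = refl
  ...     | no t≮½ = ⊥-elim (t≮½ t<½)

  maj-half : t x y ≡ ½ → maj t x y ≡ nothing
  maj-half t≡½ with x ≟ y
  ... | yes _ = refl
  ... | no _ with ½ ℚ.<? t x y
  ...   | yes ½<t = ⊥-elim (ℚ.<-irrefl (sym t≡½) ½<t)
  ...   | no _ with t x y ℚ.<? ½
  ...     | yes t<½ = ⊥-elim (ℚ.<-irrefl t≡½ t<½)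
  ...     | no _    = refl

maj-agrees : ∀ {c : ChoiceFn n} {t} → IsChoice c →
             (∀ {x y} → TorEdge c x y → ½ ℚ.< t x y) → (∀ {x y} → TorEdge c y x → t x y ℚ.< ½) →
             (∀ {x y} → c x y ≡ nothing → t x y ≡ ½) → ∀ x y → maj t x y ≡ c x y
maj-agrees {c = c} {t} isC above below half x y with c x y in cxy
... | nothing = maj-half t x y (half cxy)
... | just z with IsChoice.choose isC x y z cxy
...   | inj₁ refl = maj-below t x y x≢y (below (x≢y ∘ sym , trans (IsChoice.unord isC y x) cxy))
  where
  x≢y : x ≢ y
  x≢y = defined⇒distinct isC cxy
...   | inj₂ refl = maj-above t x y x≢y (above (x≢y , cxy))
  where
  x≢y : x ≢ y
  x≢y = defined⇒distinct isC cxy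

module _ {𝔇 : ChoiceFn n → Set} {F : Flow n} {c : ChoiceFn n} (isC : IsChoice c) (F-induces : Induces F c) where
  open Induces F-induces

  -- With uniform weights 1/N on N members, t = ½ + F / (2N): t lies on the side of ½ given by the sign of F.
  maj-cl-of-induced : ∀ {d} → Σ[ L ∈ List (ChoiceFn n) ] All 𝔇 (d ∷ L) × flowSum (d ∷ L) ≐ F → InMajCl 𝔇 c
  maj-cl-of-induced {d} (L , d∷L⊆𝔇 , sum≐F) =
    t , (uniform w (d ∷ L) , All.map⁺ (All.map (0≤w ,_) d∷L⊆𝔇) , weights-sum-to-1 , λ _ _ _ → refl) ,
    maj-agrees isC
      (λ {a} {b} ab → subst₂ ℚ._<_ (sym ½≡level0) (sym (t≡level a b)) (level-mono (arc⇒positive ab)))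
      (λ {a} {b} ba → subst₂ ℚ._<_ (sym (t≡level a b)) (sym ½≡level0) (level-mono (reversed-arc⇒negative ba)))
      (λ {a} {b} undef → trans (t≡level a b) (trans (cong level (undefined⇒zero undef)) (sym ½≡level0)))
    where
    N : ℤ
    N = ℤ.+ length (d ∷ L)
    w : ℚ
    w = 1/ ι N
    instance
      w-positive : ℚ.Positive w
      w-positive = ℚ.1/pos⇒pos (ι N)
    0≤w : 0ℚ ℚ.≤ w
    0≤w = ℚ.<⇒≤ (ℚ.positive⁻¹ w)
    t : Fin n → Fin n → ℚ
    t = combo (uniform w (d ∷ L))
    level : ℤ → ℚ
    level z = w ℚ.* (½ ℚ.* ι (N + z))
    level-mono : ∀ {x y} → x < y → level x ℚ.< level y
    level-mono x<y = ℚ.*-monoʳ-<-pos w (ℚ.*-monoʳ-<-pos ½ (ι-mono-< (ℤ.+-monoʳ-< N x<y)))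
    t≡level : ∀ a b → t a b ≡ level (F a b)
    t≡level a b = trans (combo-uniform w (d ∷ L) a b) (cong level (sum≐F a b))
    ½≡level0 : ½ ≡ level 0ℤ
    ½≡level0 = begin
      ½                    ≡⟨ ℚ.*-identityʳ ½ ⟨
      ½ ℚ.* 1ℚ             ≡⟨ cong (½ ℚ.*_) (ℚ.*-inverseˡ (ι N)) ⟨
      ½ ℚ.* (w ℚ.* ι N)    ≡⟨ x∙yz≈y∙xz ½ w (ι N) ⟩
      w ℚ.* (½ ℚ.* ι N)    ≡⟨ cong (λ z → w ℚ.* (½ ℚ.* ι z)) (ℤ.+-identityʳ N) ⟨
      level 0ℤ             ∎
    weights-sum-to-1 : weightSum (uniform w (d ∷ L)) ≡ 1ℚ
    weights-sum-to-1 = trans (weightSum-uniform w (d ∷ L)) (ℚ.*-inverseˡ (ι N))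

claim3p6 : (n : ℕ) → n ≥ 3 → (𝔇 : ChoiceFn n → Set) → (∀ d → 𝔇 d → IsFullChoice d) → (∃ λ d → 𝔇 d) → Symmetric 𝔇 → (c : ChoiceFn n) → IsChoice c → PseudoBalanced c → InMajCl 𝔇 c
claim3p6 _ (s≤s (s≤s (s≤s z≤n))) 𝔇 full (d₀ , d₀∈𝔇) sym𝔇 c isC pb =
  maj-cl-of-induced isC (cycleSum-induces pb isC {K = K} 𝔇⊆choice 0<K cycles)
                        (nonempty-realisation sym𝔇 𝔇⊆choice d₀∈𝔇 cycles)
  where
  𝔇⊆choice : ∀ d → 𝔇 d → IsChoice d
  𝔇⊆choice d = IsFullChoice.isChoice ∘ full d
  scaled-triangle : Σ[ K ∈ ℤ ] 0ℤ < K × Realises 𝔇 (K · triangle 0F 1F 2F)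
  scaled-triangle = realises-triangle₀₁₂ sym𝔇 𝔇⊆choice d₀∈𝔇 (full d₀ d₀∈𝔇)
  K : ℤ
  K = proj₁ scaled-triangle
  0<K : 0ℤ < K
  0<K = proj₁ (proj₂ scaled-triangle)
  cycles : Realises 𝔇 (K · cycleSum pb)
  cycles = realises-cycleSum pb {K = K}
    (realises-triangle sym𝔇 {K} {0F} {1F} {2F} (λ ()) (λ ()) (λ ()) (proj₂ (proj₂ scaled-triangle)))
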